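{- Let $\mathcal{A} :\equiv (A, (f, n, p))$ and $\mathcal{B} :\equiv (B, (g, m, q))$ be elements of $\sum_{X:\mathcal{U}} \mathsf{Cyclic}(X)$. Then $$(\mathcal{A} = \mathcal{B}) \simeq \sum_{\alpha : A = B} \big(\mathsf{coe}(\alpha)\circ f = g \circ \mathsf{coe}(\alpha)\big).$$
   Context: Work in homotopy type theory with a univalent universe $\mathcal{U}$ and propositional truncation $\|-\|$. $[n]$ is the standard finite type with elements $0,\dots,n-1$; for $n\ge1$, $\mathsf{pred}:[n]\to[n]$ sends $0\mapsto n-1$ and $i+1\mapsto i$. $\mathsf{Cyclic}(X) :\equiv \sum_{\varphi : X \to X}\sum_{n:\mathbb{N}} \big\| \sum_{e : X \simeq [n]} e\circ\varphi = \mathsf{pred}\circ e \big\|$. For $\alpha : A = B$, $\mathsf{coe}(\alpha): A \to B$ is coercion (transport in the identity family) along $\alpha$. -}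

{-# OPTIONS --without-K #-}
module Defs where

open import Level using (Level; _⊔_; Setω)
open import Data.Nat using (ℕ; zero; suc)
open import Data.Fin using (Fin; zero; suc; fromℕ; inject₁)
open import Data.Product using (Σ; _×_; _,_; proj₁; proj₂)
open import Relation.Binary.PropositionalEquality using (_≡_; refl)
open import Function using (_∘_; id)

private variable
  a b : Level

isProp : Set a → Set a
isProp A = (x y : A) → x ≡ y

isEquiv : {A : Set a} {B : Set b} → (A → B) → Set (a ⊔ b)
isEquiv {A = A} {B} f = (Σ (B → A) λ g → ∀ y → f (g y) ≡ y) × (Σ (B → A) λ h → ∀ x → h (f x) ≡ x)

infix 4 _≃_
_≃_ : Set a → Set b → Set (a ⊔ b)
A ≃ B = Σ (A → B) isEquiv

coe : {A B : Set a} → A ≡ B → A → B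
coe refl x = x

idEquiv : (A : Set a) → A ≃ A
idEquiv A = id , ((id , λ _ → refl) , (id , λ _ → refl))

idtoeqv : {A B : Set a} → A ≡ B → A ≃ B
idtoeqv {A = A} refl = idEquiv A

Univalence : (ℓ : Level) → Set (Level.suc ℓ)
Univalence ℓ = (A B : Set ℓ) → isEquiv (idtoeqv {A = A} {B})

happly : {A : Set a} {B : A → Set b} {f g : (x : A) → B x} → f ≡ g → (x : A) → f x ≡ g x
happly refl x = refl

-- function extensionality (a consequence of univalence, assumed for convenience)
FunExt : Setω
FunExt = ∀ {a b} {A : Set a} {B : A → Set b} (f g : (x : A) → B x) → isEquiv (happly {f = f} {g})

record PropTrunc : Setω where
  field
    ∥_∥ : ∀ {a} → Set a → Set a
    ∣_∣ : ∀ {a} {A : Set a} → A → ∥ A ∥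
    ∥∥-isProp : ∀ {a} {A : Set a} → isProp ∥ A ∥
    ∥∥-rec : ∀ {a b} {A : Set a} {P : Set b} → isProp P → (A → P) → ∥ A ∥ → P

predFin : ∀ {n} → Fin n → Fin n
predFin {suc n} zero = fromℕ n
predFin {suc n} (suc i) = inject₁ i

Cyclic : PropTrunc → Set a → Set a
Cyclic T X = Σ (X → X) λ φ → Σ ℕ λ n →
  ∥ Σ (X ≃ Fin n) (λ e → proj₁ e ∘ φ ≡ predFin ∘ proj₁ e) ∥
  where open PropTrunc T

{-# OPTIONS --safe --without-K #-}
-- A path (A , 𝒜) ≡ (B , ℬ) is a
-- path α : A ≡ B together with a path from the transport of 𝒜 along α to ℬ. Everything in a
-- cyclic structure except the map φ is a proposition: the truncation is one by fiat, and n is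
-- the cardinality of the carrier, hence determined by it. So the second component is just a
-- path between the maps, which by path induction on α is the square coe α ∘ f ≡ g ∘ coe α.
module Submission where

open import Defs
open import Level using (Level)
open import Data.Nat using (ℕ)
open import Data.Nat.Properties using (≡-irrelevant)
open import Data.Fin using (Fin)
open import Data.Fin.Properties using (cantor-schröder-bernstein)
open import Data.Product using (Σ; _,_; proj₁)
open import Data.Product.Properties using (Σ-≡,≡→≡; Σ-≡,≡↔≡)
open import Data.Product.Function.Dependent.Propositional using (congˡ)
open import Function using (_∘_; _↔_; Inverse; mk↔ₛ′)
open import Function.Definitions using (Injective)
open import Function.Properties.Inverse using (↔-sym; ↔-trans)
open import Relation.Binary.PropositionalEquality
  using (_≡_; refl; sym; trans; cong; subst; trans-symˡ)

private variable
  a b : Level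
  A B X : Set a

↔⇒≃ : A ↔ B → A ≃ B
↔⇒≃ A↔B = to , (from , strictlyInverseˡ) , (from , strictlyInverseʳ)
  where open Inverse A↔B

leftInverse⇒injective : (f : A → B) (g : B → A) →
  (∀ x → g (f x) ≡ x) → Injective _≡_ _≡_ f
leftInverse⇒injective f g gf {x} {y} fx≡fy =
  trans (sym (gf x)) (trans (cong g fx≡fy) (gf y))

≃-Fin-unique : {m n : ℕ} → X ≃ Fin m → X ≃ Fin n → m ≡ n
≃-Fin-unique (f , (g , fg) , (h , hf)) (f′ , (g′ , f′g′) , (h′ , h′f′)) =
  cantor-schröder-bernstein
    (leftInverse⇒injective g f fg ∘ leftInverse⇒injective f′ h′ h′f′)
    (leftInverse⇒injective g′ f′ f′g′ ∘ leftInverse⇒injective f h hf)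

-- The standard trick making a proposition a set: the normalised proof sends (p , p) to refl.
isProp-normalise : isProp A → isProp A
isProp-normalise prop p q = trans (sym (prop p p)) (prop p q)

isProp-normalise-refl : (prop : isProp A) (p : A) → isProp-normalise prop p p ≡ refl
isProp-normalise-refl prop p = trans-symˡ (prop p p)

Σ-≡↔proj₁-≡ : {P : A → Set b} → (∀ x → isProp (P x)) →
  {u v : Σ A P} → (u ≡ v) ↔ (proj₁ u ≡ proj₁ v)
Σ-≡↔proj₁-≡ {A = A} {P = P} prop = mk↔ₛ′ (cong proj₁) pair proj₁-pair pair-proj₁
  where
  pair : {u v : Σ A P} → proj₁ u ≡ proj₁ v → u ≡ v
  pair {x , p} {.x , q} refl = cong (x ,_) (isProp-normalise (prop x) p q)

  proj₁-cong-pair : {x : A} {p q : P x} (p≡q : p ≡ q) → cong proj₁ (cong (_,_ {B = P} x) p≡q) ≡ refl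
  proj₁-cong-pair refl = refl

  proj₁-pair : {u v : Σ A P} (x≡y : proj₁ u ≡ proj₁ v) → cong proj₁ (pair {u} {v} x≡y) ≡ x≡y
  proj₁-pair {x , p} {.x , q} refl = proj₁-cong-pair (isProp-normalise (prop x) p q)

  pair-proj₁ : {u v : Σ A P} (u≡v : u ≡ v) → pair (cong proj₁ u≡v) ≡ u≡v
  pair-proj₁ {x , p} refl = cong (cong (x ,_)) (isProp-normalise-refl (prop x) p)

module _ (T : PropTrunc) where
  open PropTrunc T

  IsCyclic : (X → X) → Set _
  IsCyclic {X = X} φ = Σ ℕ λ n → ∥ Σ (X ≃ Fin n) (λ e → proj₁ e ∘ φ ≡ predFin ∘ proj₁ e) ∥

  IsCyclic-isProp : (φ : X → X) → isProp (IsCyclic φ)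
  IsCyclic-isProp φ (m , p) (n , q) = Σ-≡,≡→≡ (m≡n , ∥∥-isProp _ q)
    where
    m≡n : m ≡ n
    m≡n = ∥∥-rec ≡-irrelevant (λ (e , _) →
            ∥∥-rec ≡-irrelevant (λ (e′ , _) → ≃-Fin-unique e e′) q) p

  subst-Cyclic-≡↔ : (α : A ≡ B) {𝒜 : Cyclic T A} {ℬ : Cyclic T B} →
    (subst (Cyclic T) α 𝒜 ≡ ℬ) ↔ (coe α ∘ proj₁ 𝒜 ≡ proj₁ ℬ ∘ coe α)
  subst-Cyclic-≡↔ refl = Σ-≡↔proj₁-≡ IsCyclic-isProp

lemma2p13 : {ℓ : Level} (T : PropTrunc) → Univalence ℓ → FunExt →
    {A B : Set ℓ} (𝒜 : Cyclic T A) (ℬ : Cyclic T B) →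
    (_≡_ {A = Σ (Set ℓ) (Cyclic T)} (A , 𝒜) (B , ℬ))
      ≃ Σ (A ≡ B) (λ α → coe α ∘ proj₁ 𝒜 ≡ proj₁ ℬ ∘ coe α)
lemma2p13 T _ _ 𝒜 ℬ =
  ↔⇒≃ (↔-trans (↔-sym Σ-≡,≡↔≡) (congˡ (subst-Cyclic-≡↔ T _)))
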